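{- Let $T$ be a strongly consistent $\mathcal{L}$-theory in $RGL^*$ and let $\varphi,\psi$ be $\mathcal{L}$-sentences. Then at least one of $T\cup\{\varphi\to\psi\}$ and $T\cup\{\psi\to\varphi\}$ is strongly consistent.
   Context: Syntax. Fix a first-order language $\mathcal{L}$ with countably many predicate, function and constant symbols. Formulas of $RGL^*$ are built from atomic formulas and nullary connectives $\bar r$, one for each $r\in[0,1]\cap\mathbb{Q}$ (including $\bar0,\bar1$), using $\wedge,\to,\forall,\exists$; an $\mathcal{L}$-theory is a set of sentences. Abbreviations: $\neg\varphi:=\varphi\to\bar1$; $\varphi\vee\psi:=((\varphi\to\psi)\to\psi)\wedge((\psi\to\varphi)\to\varphi)$; $\varphi\leftrightarrow\psi:=(\varphi\to\psi)\wedge(\psi\to\varphi)$. Proof system. Axioms (all formulas $\varphi,\psi,\chi$, rationals $r,s\in[0,1]$): (G1) $(\varphi\to\psi)\to((\psi\to\chi)\to(\varphi\to\chi))$; (G2) $(\varphi\wedge\psi)\to\varphi$; (G3) $(\varphi\wedge\psi)\to(\psi\wedge\varphi)$; (G4) $\varphi\to(\varphi\wedge\varphi)$; (G5) $(\varphi\to(\psi\to\chi))\leftrightarrow((\varphi\wedge\psi)\to\chi)$; (G6) $((\varphi\to\psi)\to\chi)\to(((\psi\to\varphi)\to\chi)\to\chi)$; (G7) $\bar1\to\varphi$; (G$\forall$1) $(\forall x\,\varphi(x))\to\varphi(t)$, $t$ substitutable; (G$\forall$2) $(\forall x(\psi\to\varphi(x)))\to(\psi\to\forall x\,\varphi(x))$,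 $x$ not free in $\psi$; (G$\forall$3) $(\forall x(\psi\vee\varphi(x)))\to(\psi\vee\forall x\,\varphi(x))$, $x$ not free in $\psi$; (G$\exists$1) $\varphi(t)\to\exists x\,\varphi(x)$; (G$\exists$2) $(\exists x(\psi\to\varphi(x)))\to(\psi\to\exists x\,\varphi(x))$, $x$ not free in $\psi$; (RGL1) $(\bar r\wedge\bar s)\leftrightarrow\overline{\max\{r,s\}}$; (RGL2) $\bar r\to\bar s$ if $r\ge s$, and $(\bar r\to\bar s)\leftrightarrow\bar s$ if $r<s$; (RGL3) $\neg\neg\bar r$ for $r<1$. Rules: modus ponens and generalization. $T\vdash\varphi$ means derivable from the axioms and $T$. $T$ is strongly consistent if $T\nvdash\bar r$ for every rational $r>0$. -}

module Defs where

open import Data.Nat using (ℕ; _≡ᵇ_)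
open import Data.Bool using (Bool; true; false; not; _∧_; _∨_; if_then_else_)
open import Data.Vec using (Vec; []; _∷_)
open import Data.Rational using (ℚ; 0ℚ; 1ℚ; _≤_; _<_; _⊔_)
open import Data.Product using (_×_)
open import Data.Sum using (_⊎_)
open import Relation.Binary.PropositionalEquality using (_≡_)
open import Relation.Nullary using (¬_)
open import Function.Definitions using (Injective)
open import Data.Rational.Properties using (≤-refl; nonNegative⁻¹)

-- A first-order language with countably many predicate, function and
-- constant symbols (countable = injectively encodable into ℕ).

record Language : Set₁ where
  field
    Pred     : Set
    Fun      : Set
    Const    : Set
    predArity : Pred → ℕ
    funArity  : Fun → ℕ
    predCode  : Pred → ℕ
    funCode   : Fun → ℕ
    constCode : Const → ℕ
    predCode-inj  : Injective _≡_ _≡_ predCode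
    funCode-inj   : Injective _≡_ _≡_ funCode
    constCode-inj : Injective _≡_ _≡_ constCode

module Syntax (L : Language) where
  open Language L

  data Term : Set where
    var : ℕ → Term
    con : Const → Term
    app : (f : Fun) → Vec Term (funArity f) → Term

  data Formula : Set where
    atom : (p : Pred) → Vec Term (predArity p) → Formula
    rc   : (r : ℚ) → .(0ℚ ≤ r) → .(r ≤ 1ℚ) → Formula
    _∧'_ : Formula → Formula → Formula
    _⇒_  : Formula → Formula → Formula
    all  : ℕ → Formula → Formula
    ex   : ℕ → Formula → Formula

  infixr 5 _⇒_
  infixl 6 _∧'_

  1̄ : Formula
  1̄ = rc 1ℚ (nonNegative⁻¹ 1ℚ) ≤-refl

  ¬' : Formula → Formula
  ¬' φ = φ ⇒ 1̄

  _∨'_ : Formula → Formula → Formula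
  φ ∨' ψ = ((φ ⇒ ψ) ⇒ ψ) ∧' ((ψ ⇒ φ) ⇒ φ)

  _⇔_ : Formula → Formula → Formula
  φ ⇔ ψ = (φ ⇒ ψ) ∧' (ψ ⇒ φ)

  occT  : ℕ → Term → Bool
  occTs : ∀ {k} → ℕ → Vec Term k → Bool
  occT x (var y)    = x ≡ᵇ y
  occT x (con c)    = false
  occT x (app f ts) = occTs x ts
  occTs x []       = false
  occTs x (t ∷ ts) = occT x t ∨ occTs x ts

  free : ℕ → Formula → Bool
  free x (atom p ts) = occTs x ts
  free x (rc r _ _)  = false
  free x (φ ∧' ψ)    = free x φ ∨ free x ψ
  free x (φ ⇒ ψ)     = free x φ ∨ free x ψ
  free x (all y φ)   = not (x ≡ᵇ y) ∧ free x φ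
  free x (ex y φ)    = not (x ≡ᵇ y) ∧ free x φ

  Sentence : Formula → Set
  Sentence φ = ∀ x → free x φ ≡ false

  subT  : ℕ → Term → Term → Term
  subTs : ∀ {k} → ℕ → Term → Vec Term k → Vec Term k
  subT x t (var y)    = if x ≡ᵇ y then t else var y
  subT x t (con c)    = con c
  subT x t (app f ts) = app f (subTs x t ts)
  subTs x t []       = []
  subTs x t (s ∷ ss) = subT x t s ∷ subTs x t ss

  sub : ℕ → Term → Formula → Formula
  sub x t (atom p ts) = atom p (subTs x t ts)
  sub x t (rc r a b)  = rc r a b
  sub x t (φ ∧' ψ)    = sub x t φ ∧' sub x t ψ
  sub x t (φ ⇒ ψ)     = sub x t φ ⇒ sub x t ψ
  sub x t (all y φ)   = if x ≡ᵇ y then all y φ else all y (sub x t φ)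
  sub x t (ex y φ)    = if x ≡ᵇ y then ex y φ else ex y (sub x t φ)

  substitutable : Term → ℕ → Formula → Bool
  substitutable t x (atom p ts) = true
  substitutable t x (rc r _ _)  = true
  substitutable t x (φ ∧' ψ)    = substitutable t x φ ∧ substitutable t x ψ
  substitutable t x (φ ⇒ ψ)     = substitutable t x φ ∧ substitutable t x ψ
  substitutable t x (all y φ)   =
    not (free x (all y φ)) ∨ (not (occT y t) ∧ substitutable t x φ)
  substitutable t x (ex y φ)    =
    not (free x (ex y φ)) ∨ (not (occT y t) ∧ substitutable t x φ)

  data Axiom : Formula → Set where
    G1 : ∀ φ ψ χ → Axiom ((φ ⇒ ψ) ⇒ ((ψ ⇒ χ) ⇒ (φ ⇒ χ)))
    G2 : ∀ φ ψ → Axiom ((φ ∧' ψ) ⇒ φ)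
    G3 : ∀ φ ψ → Axiom ((φ ∧' ψ) ⇒ (ψ ∧' φ))
    G4 : ∀ φ → Axiom (φ ⇒ (φ ∧' φ))
    G5 : ∀ φ ψ χ → Axiom ((φ ⇒ (ψ ⇒ χ)) ⇔ ((φ ∧' ψ) ⇒ χ))
    G6 : ∀ φ ψ χ → Axiom (((φ ⇒ ψ) ⇒ χ) ⇒ (((ψ ⇒ φ) ⇒ χ) ⇒ χ))
    G7 : ∀ φ → Axiom (1̄ ⇒ φ)
    G∀1 : ∀ x φ t → substitutable t x φ ≡ true →
          Axiom (all x φ ⇒ sub x t φ)
    G∀2 : ∀ x ψ φ → free x ψ ≡ false →
          Axiom (all x (ψ ⇒ φ) ⇒ (ψ ⇒ all x φ))
    G∀3 : ∀ x ψ φ → free x ψ ≡ false →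
          Axiom (all x (ψ ∨' φ) ⇒ (ψ ∨' all x φ))
    G∃1 : ∀ x φ t → substitutable t x φ ≡ true →
          Axiom (sub x t φ ⇒ ex x φ)
    G∃2 : ∀ x ψ φ → free x ψ ≡ false →
          Axiom (ex x (ψ ⇒ φ) ⇒ (ψ ⇒ ex x φ))
    RGL1 : ∀ r s .(r0 : 0ℚ ≤ r) .(r1 : r ≤ 1ℚ) .(s0 : 0ℚ ≤ s) .(s1 : s ≤ 1ℚ)
             .(m0 : 0ℚ ≤ r ⊔ s) .(m1 : r ⊔ s ≤ 1ℚ) →
           Axiom ((rc r r0 r1 ∧' rc s s0 s1) ⇔ rc (r ⊔ s) m0 m1)
    RGL2a : ∀ r s .(r0 : 0ℚ ≤ r) .(r1 : r ≤ 1ℚ) .(s0 : 0ℚ ≤ s) .(s1 : s ≤ 1ℚ) →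
            s ≤ r → Axiom (rc r r0 r1 ⇒ rc s s0 s1)
    RGL2b : ∀ r s .(r0 : 0ℚ ≤ r) .(r1 : r ≤ 1ℚ) .(s0 : 0ℚ ≤ s) .(s1 : s ≤ 1ℚ) →
            r < s → Axiom ((rc r r0 r1 ⇒ rc s s0 s1) ⇔ rc s s0 s1)
    RGL3 : ∀ r .(r0 : 0ℚ ≤ r) .(r1 : r ≤ 1ℚ) → r < 1ℚ →
           Axiom (¬' (¬' (rc r r0 r1)))

  Theory : Set₁
  Theory = Formula → Set

  IsTheory : Theory → Set
  IsTheory T = ∀ φ → T φ → Sentence φ

  _∪｛_｝ : Theory → Formula → Theory
  (T ∪｛ χ ｝) θ = T θ ⊎ θ ≡ χ

  data _⊢_ (T : Theory) : Formula → Set where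
    ax  : ∀ {φ} → Axiom φ → T ⊢ φ
    hyp : ∀ {φ} → T φ → T ⊢ φ
    mp  : ∀ {φ ψ} → T ⊢ φ → T ⊢ (φ ⇒ ψ) → T ⊢ ψ
    gen : ∀ {φ} x → T ⊢ φ → T ⊢ all x φ

  infix 3 _⊢_

  -- T is strongly consistent: T ⊬ r̄ for every rational r > 0 (r̄ exists
  -- only for r ∈ [0,1]).
  StronglyConsistent : Theory → Set
  StronglyConsistent T =
    ∀ r .(r0 : 0ℚ ≤ r) .(r1 : r ≤ 1ℚ) → 0ℚ < r → ¬ (T ⊢ rc r r0 r1)

open Syntax public

{-# OPTIONS --safe #-}
module Submission where

-- Gödel prelinearity (G6) turns derivations of (φ → ψ) → r̄ and (ψ → φ) → s̄
-- into a derivation of the weaker of r̄ and s̄. If both extensions of T derive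
-- positive constants, the deduction theorem (valid for sentences) moves φ → ψ
-- and ψ → φ into the conclusions, RGL2 weakens both constants to the smaller
-- one, and prelinearity derives it from T alone, against strong consistency.

open import Defs using (Language; module Syntax)
open import Data.Empty using (⊥)
open import Data.Product using (_×_; _,_)
open import Data.Rational using (0ℚ; _≤_; _<_)
open import Data.Rational.Properties using (≤-total)
open import Data.Sum using (_⊎_; inj₁; inj₂)
open import Relation.Binary.PropositionalEquality using (refl)
open import Relation.Nullary using (¬_)

module Derivations (L : Language) where
  open Syntax L

  private
    variable
      T : Theory
      φ ψ χ θ : Formula

  ∧-elimˡ : T ⊢ φ ∧' ψ → T ⊢ φ
  ∧-elimˡ {φ = φ} {ψ} d = mp d (ax (G2 φ ψ))

  ∧-elimʳ : T ⊢ φ ∧' ψ → T ⊢ ψ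
  ∧-elimʳ {φ = φ} {ψ} d = ∧-elimˡ (mp d (ax (G3 φ ψ)))

  ⇒-trans : T ⊢ φ ⇒ ψ → T ⊢ ψ ⇒ χ → T ⊢ φ ⇒ χ
  ⇒-trans {φ = φ} {ψ} {χ} d e = mp e (mp d (ax (G1 φ ψ χ)))

  ⇒-curry : T ⊢ φ ∧' ψ ⇒ χ → T ⊢ φ ⇒ ψ ⇒ χ
  ⇒-curry {φ = φ} {ψ} {χ} d = mp d (∧-elimʳ (ax (G5 φ ψ χ)))

  ⇒-uncurry : T ⊢ φ ⇒ ψ ⇒ χ → T ⊢ φ ∧' ψ ⇒ χ
  ⇒-uncurry {φ = φ} {ψ} {χ} d = mp d (∧-elimˡ (ax (G5 φ ψ χ)))

  ⇒-refl : T ⊢ φ ⇒ φ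
  ⇒-refl {φ = φ} = ⇒-trans (ax (G4 φ)) (ax (G2 φ φ))

  ⇒-const : T ⊢ φ ⇒ ψ ⇒ φ
  ⇒-const {φ = φ} {ψ} = ⇒-curry (ax (G2 φ ψ))

  ⇒-swap : T ⊢ φ ⇒ ψ ⇒ χ → T ⊢ ψ ⇒ φ ⇒ χ
  ⇒-swap {φ = φ} {ψ} d = ⇒-curry (⇒-trans (ax (G3 ψ φ)) (⇒-uncurry d))

  ⇒-contract : T ⊢ φ ⇒ φ ⇒ ψ → T ⊢ φ ⇒ ψ
  ⇒-contract {φ = φ} d = ⇒-trans (ax (G4 φ)) (⇒-uncurry d)

  ⇒-mp : T ⊢ χ ⇒ φ → T ⊢ χ ⇒ φ ⇒ ψ → T ⊢ χ ⇒ ψ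
  ⇒-mp d e = ⇒-contract (⇒-trans d (⇒-swap e))

  deduction : Sentence χ → T ∪｛ χ ｝ ⊢ θ → T ⊢ χ ⇒ θ
  deduction sχ (ax a)            = mp (ax a) ⇒-const
  deduction sχ (hyp (inj₁ θ∈T))  = mp (hyp θ∈T) ⇒-const
  deduction sχ (hyp (inj₂ refl)) = ⇒-refl
  deduction sχ (mp d e)          = ⇒-mp (deduction sχ d) (deduction sχ e)
  deduction {χ = χ} sχ (gen {φ} x d) =
    mp (gen x (deduction sχ d)) (ax (G∀2 x χ φ (sχ x)))

  prelinearity : T ⊢ (φ ⇒ ψ) ⇒ χ → T ⊢ (ψ ⇒ φ) ⇒ χ → T ⊢ χ
  prelinearity {φ = φ} {ψ} {χ} d e = mp e (mp d (ax (G6 φ ψ χ)))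

  ⇒-rc-weaken : ∀ {r s} .{r0 r1 s0 s1} →
                s ≤ r → T ⊢ χ ⇒ rc r r0 r1 → T ⊢ χ ⇒ rc s s0 s1
  ⇒-rc-weaken {r = r} {s} {r0} {r1} {s0} {s1} s≤r d =
    ⇒-trans d (ax (RGL2a r s r0 r1 s0 s1 s≤r))

  prelinearity-rc : ∀ {r s} .{r0 r1 s0 s1} →
                    T ⊢ (φ ⇒ ψ) ⇒ rc r r0 r1 → T ⊢ (ψ ⇒ φ) ⇒ rc s s0 s1 →
                    T ⊢ rc r r0 r1 ⊎ T ⊢ rc s s0 s1
  prelinearity-rc {r = r} {s} d e with ≤-total r s
  ... | inj₁ r≤s = inj₁ (prelinearity d (⇒-rc-weaken r≤s e))
  ... | inj₂ s≤r = inj₂ (prelinearity (⇒-rc-weaken s≤r d) e)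

  Sentence-⇒ : Sentence φ → Sentence ψ → Sentence (φ ⇒ ψ)
  Sentence-⇒ sφ sψ x rewrite sφ x | sψ x = refl

  StronglyConsistent-prelinear :
    StronglyConsistent T → Sentence φ → Sentence ψ →
    ¬ StronglyConsistent (T ∪｛ φ ⇒ ψ ｝) → StronglyConsistent (T ∪｛ ψ ⇒ φ ｝)
  StronglyConsistent-prelinear {T} {φ} {ψ} scT sφ sψ ¬sc s s0 s1 0<s e =
    ¬sc λ r r0 r1 0<r d →
      refute 0<r 0<s
        (prelinearity-rc (deduction (Sentence-⇒ {φ = φ} {ψ} sφ sψ) d)
                         (deduction (Sentence-⇒ {φ = ψ} {φ} sψ sφ) e))
    where
    refute : ∀ {r} .{r0 r1} → 0ℚ < r → 0ℚ < s →
             T ⊢ rc r r0 r1 ⊎ T ⊢ rc s s0 s1 → ⊥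
    refute {r} {r0} {r1} 0<r _ (inj₁ d) = scT r r0 r1 0<r d
    refute _ 0<s (inj₂ e) = scT s s0 s1 0<s e

open Defs
open Derivations using (StronglyConsistent-prelinear)

mainTheorem5 : (L : Language) (T : Theory L) → IsTheory L T →
    StronglyConsistent L T →
    (φ ψ : Formula L) → Sentence L φ → Sentence L ψ →
    ¬ (¬ StronglyConsistent L (_∪｛_｝ L T (φ ⇒ ψ))
    × ¬ StronglyConsistent L (_∪｛_｝ L T (ψ ⇒ φ)))
mainTheorem5 L T _ scT φ ψ sφ sψ (¬sc₁ , ¬sc₂) =
  ¬sc₂ (StronglyConsistent-prelinear L scT sφ sψ ¬sc₁)
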